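{- Let $G=(V,E)$ be an infinite graph and $\omega$ an end of $G$ with end tangle $\tau=\tau_\omega$. Then $\tau$ has an infinite relative decider, i.e. there is an infinite set $X\subseteq V$ with $|A\cap X|<|B\cap X|$ for every $(A,B)\in\tau$.
   Context: A separation of $G$ is a set $\{A,B\}$ with $A\cup B=V$ such that $G$ has no edge between $A\setminus B$ and $B\setminus A$; its orientations are $(A,B)$ and $(B,A)$. $\vec S$ denotes the set of all oriented separations $(A,B)$ of $G$ with $A\cap B$ finite. The end tangle of an end $\omega$ is $\tau_\omega=\{(A,B)\in\vec S : \text{every ray of }\omega\text{ has a tail in }B\}$. -}

module Defs where

open import Data.Nat using (ℕ; _≤_)
open import Data.Product using (Σ; ∃; ∃-syntax; _×_; _,_; proj₁)
open import Data.Sum using (_⊎_)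
open import Data.Unit using (⊤)
open import Data.List using (List)
open import Data.List.Membership.Propositional using (_∈_)
open import Relation.Nullary using (¬_)
open import Relation.Binary.PropositionalEquality using (_≡_)

Subset : Set → Set₁
Subset V = V → Set

_∩_ : {V : Set} → Subset V → Subset V → Subset V
(A ∩ B) v = A v × B v

Finite : {V : Set} → Subset V → Set
Finite {V} S = Σ (List V) λ xs → ∀ v → S v → v ∈ xs

Infinite : {V : Set} → Subset V → Set
Infinite S = ¬ Finite S

-- Cardinal comparison of subsets: |P| ≤ |Q| iff there is an injection P → Q.
_≼_ : {V : Set} → Subset V → Subset V → Set
_≼_ {V} P Q = Σ (Σ V P → Σ V Q) λ f →
  ∀ x y → proj₁ (f x) ≡ proj₁ (f y) → proj₁ x ≡ proj₁ y

_≺_ : {V : Set} → Subset V → Subset V → Set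
P ≺ Q = (P ≼ Q) × ¬ (Q ≼ P)

record Graph : Set₁ where
  field
    V     : Set
    E     : V → V → Set
    E-sym : ∀ {u v} → E u v → E v u
    E-irr : ∀ {v} → ¬ E v v

module _ (G : Graph) where
  open Graph G

  InfiniteGraph : Set
  InfiniteGraph = Infinite {V} (λ _ → ⊤)

  record Ray : Set where
    field
      vtx  : ℕ → V
      inj  : ∀ m n → vtx m ≡ vtx n → m ≡ n
      adj  : ∀ n → E (vtx n) (vtx (Data.Nat.suc n))
  open Ray public

  HasTailIn : Ray → Subset V → Set
  HasTailIn R B = ∃[ n ] (∀ m → n ≤ m → B (vtx R m))

  data Walk (S : Subset V) : V → V → Set where
    here : ∀ {v} → ¬ S v → Walk S v v
    step : ∀ {u w v} → ¬ S u → E u w → Walk S w v → Walk S u v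

  -- Rays are equivalent if for every finite S they have tails in the
  -- same component of G − S.
  RayEquiv : Ray → Ray → Set₁
  RayEquiv R₁ R₂ = ∀ (S : Subset V) → Finite S →
    ∃[ i ] ∃[ j ] ((∀ k → i ≤ k → ¬ S (vtx R₁ k)) ×
                   (∀ k → j ≤ k → ¬ S (vtx R₂ k)) ×
                   Walk S (vtx R₁ i) (vtx R₂ j))

  record End : Set₁ where
    field
      rays     : Ray → Set
      nonempty : Σ Ray rays
      related  : ∀ R R′ → rays R → rays R′ → RayEquiv R R′
      closed   : ∀ R R′ → rays R → RayEquiv R R′ → rays R′
  open End public

  record IsSep (A B : Subset V) : Set where
    field
      cover    : ∀ v → A v ⊎ B v
      no-edge  : ∀ u v → A u → ¬ B u → B v → ¬ A v → ¬ E u v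
      fin-sep  : Finite (A ∩ B)

  InEndTangle : End → (A B : Subset V) → Set
  InEndTangle ω A B = IsSep A B × (∀ R → rays ω R → HasTailIn R B)

-- Take X to be the vertex set of a ray R of ω.  Every (A , B) ∈ τ has R eventually in B,
-- so A ∩ X lies in an initial segment of R together with the finite separator A ∩ B and is
-- finite, while shifting R along its tail injects X, and hence A ∩ X, into B ∩ X.  The
-- shifted ray is an injective sequence in B ∩ X, which by the pigeonhole principle cannot
-- be injected into the finite set A ∩ X.
module Submission where

open import Defs
open import Data.Product using (Σ; ∃-syntax; _×_; _,_; proj₁; proj₂)
open import Data.Nat using (ℕ; _+_; _≤_)
open import Data.Nat.Properties using (+-cancelˡ-≡; m≤m+n; n<1+n; _<?_; ≮⇒≥)
open import Data.Fin using (toℕ)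
open import Data.Fin.Properties using (pigeonhole; toℕ-injective; <⇒≢)
open import Data.List using (List; length; lookup; applyUpTo; _++_)
open import Data.List.Membership.Propositional using (_∈_)
open import Data.List.Membership.Propositional.Properties using (∈-applyUpTo⁺; ∈-++⁺ˡ; ∈-++⁺ʳ)
open import Data.List.Relation.Unary.Any using (index)
open import Data.List.Relation.Unary.Any.Properties using (lookup-index)
open import Function.Definitions using (Injective)
open import Relation.Nullary using (¬_; yes; no)
open import Relation.Binary.PropositionalEquality using (_≡_; refl; sym; trans; cong)

private
  variable
    V : Set
    P Q R : Subset V

Range : (ℕ → V) → Subset V
Range f v = ∃[ n ] f n ≡ v

InjectiveSequenceIn : Subset V → Set
InjectiveSequenceIn {V} S = Σ (ℕ → V) λ f → Injective _≡_ _≡_ f × (∀ n → S (f n))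

index-injective : {xs : List V} {x y : V} (p : x ∈ xs) (q : y ∈ xs) → index p ≡ index q → x ≡ y
index-injective {xs = xs} p q eq =
  trans (lookup-index p) (trans (cong (lookup xs) eq) (sym (lookup-index q)))

injectiveSequence-⊈-list : (xs : List V) (f : ℕ → V) → Injective _≡_ _≡_ f → ¬ (∀ n → f n ∈ xs)
injectiveSequence-⊈-list xs f f-inj f∈xs
  with i , j , i<j , eq ← pigeonhole (n<1+n (length xs)) (λ k → index (f∈xs (toℕ k)))
  = <⇒≢ i<j (toℕ-injective (f-inj (index-injective (f∈xs _) (f∈xs _) eq)))

injectiveSequence⇒infinite : InjectiveSequenceIn P → Infinite P
injectiveSequence⇒infinite (f , f-inj , f∈P) (xs , P⊆xs) =
  injectiveSequence-⊈-list xs f f-inj (λ n → P⊆xs (f n) (f∈P n))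

⊆⇒≼ : (∀ v → P v → Q v) → P ≼ Q
⊆⇒≼ P⊆Q = (λ (v , p) → v , P⊆Q v p) , λ _ _ eq → eq

≼-trans : P ≼ Q → Q ≼ R → P ≼ R
≼-trans (f , f-inj) (g , g-inj) = (λ x → g (f x)) , λ x y eq → f-inj x y (g-inj (f x) (f y) eq)

injectiveSequence-≼ : InjectiveSequenceIn P → P ≼ Q → InjectiveSequenceIn Q
injectiveSequence-≼ (f , f-inj , f∈P) (g , g-inj) =
  (λ n → proj₁ (g (f n , f∈P n))) , (λ eq → f-inj (g-inj _ _ eq)) , (λ n → proj₂ (g (f n , f∈P n)))

injectiveSequence⇒⋠finite : InjectiveSequenceIn Q → Finite P → ¬ (Q ≼ P)
injectiveSequence⇒⋠finite seq finite Q≼P = injectiveSequence⇒infinite (injectiveSequence-≼ seq Q≼P) finite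

range-injectiveSequence : {f : ℕ → V} → Injective _≡_ _≡_ f → InjectiveSequenceIn (Range f)
range-injectiveSequence {f = f} f-inj = f , f-inj , λ n → n , refl

module _ {f : ℕ → V} {B : Subset V} {N : ℕ} (tail : ∀ m → N ≤ m → B (f m)) where

  range-≼-tail : Injective _≡_ _≡_ f → Range f ≼ (B ∩ Range f)
  range-≼-tail f-inj =
    (λ (_ , n , _) → f (N + n) , tail (N + n) (m≤m+n N n) , N + n , refl) ,
    λ { (_ , m , refl) (_ , n , refl) eq → cong f (+-cancelˡ-≡ N m n (f-inj eq)) }

  ∩-range-finite : {A : Subset V} → Finite (A ∩ B) → Finite (A ∩ Range f)
  ∩-range-finite {A} (xs , A∩B⊆xs) = applyUpTo f N ++ xs , ⊆list
    where
    ⊆list : ∀ v → (A ∩ Range f) v → v ∈ applyUpTo f N ++ xs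
    ⊆list v (a , n , refl) with n <? N
    ... | yes n<N = ∈-++⁺ˡ (∈-applyUpTo⁺ f n<N)
    ... | no  n≮N = ∈-++⁺ʳ (applyUpTo f N) (A∩B⊆xs (f n) (a , tail n (≮⇒≥ n≮N)))

proposition4p3 : (G : Graph) → InfiniteGraph G → (ω : End G) →
    Σ (Subset (Graph.V G)) (λ X → Infinite X ×
    (∀ (A B : Subset (Graph.V G)) → InEndTangle G ω A B → (A ∩ X) ≺ (B ∩ X)))
proposition4p3 G _ ω = Range f , injectiveSequence⇒infinite (range-injectiveSequence f-inj) , decides
  where
  ray : Ray G
  ray = proj₁ (nonempty ω)

  f : ℕ → Graph.V G
  f = vtx ray

  f-inj : Injective _≡_ _≡_ f
  f-inj = inj ray _ _

  decides : ∀ A B → InEndTangle G ω A B → (A ∩ Range f) ≺ (B ∩ Range f)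
  decides A B (sep , tails) with N , tail ← tails ray (proj₂ (nonempty ω)) =
    ≼-trans (⊆⇒≼ (λ _ → proj₂)) shift ,
    injectiveSequence⇒⋠finite (injectiveSequence-≼ (range-injectiveSequence f-inj) shift)
      (∩-range-finite tail (IsSep.fin-sep sep))
    where
    shift : Range f ≼ (B ∩ Range f)
    shift = range-≼-tail tail f-inj
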